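{- Let $\mathcal{M}=(W,\Sigma,V)$ and $\mathcal{M}'=(W',\Sigma',V')$ be inquisitive modal models. If $Z$ is a bisimulation between $\mathcal{M}$ and $\mathcal{M}'$, then its restriction to worlds $Z_\bullet:=Z\cap(W\times W')$ is a world-bisimulation. Conversely, if $Y$ is a world-bisimulation between $\mathcal{M}$ and $\mathcal{M}'$, then $Y\cup\overline{Y}$ is a bisimulation.
   Context: An inquisitive modal model over atoms $\mathcal{P}$ is $(W,\Sigma,V)$ with $V:\mathcal{P}\to\wp(W)$ and $\Sigma(w)$ a non-empty, subset-closed family of subsets of $W$ for each $w\in W$. A bisimulation is a non-empty relation $Z\subseteq (W\times W')\cup(\wp(W)\times\wp(W'))$ such that: if $wZw'$ then $w\in V(p)\iff w'\in V'(p)$ for all $p\in\mathcal{P}$; if $sZs'$ then every $w\in s$ is $Z$-related to some $w'\in s'$ and every $w'\in s'$ is $Z$-related from some $w\in s$; if $wZw'$ then every $s\in\Sigma(w)$ has some $s'\in\Sigma'(w')$ with $sZs'$ and vice versa. The lifting of $Y\subseteq W\times W'$ is the relation $\overline Y\subseteq\wp(W)\times\wp(W')$ with $s\overline Ys'$ iff every $w\in s$ has some $w'\in s'$ with $wYw'$ and every $w'\in s'$ has some $w\in s$ with $wYw'$. A world-bisimulation is a non-empty $Y\subseteq W\times W'$ such that whenever $wYw'$: $w\in V(p)\iff w'\in V'(p)$ for all $p$; every $s\in\Sigma(w)$ has some $s'\in\Sigma'(w')$ with $s\overline Ys'$; and every $s'\in\Sigma'(w')$ has some $s\in\Sigma(w)$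 with $s\overline Ys'$. -}

module Defs where

open import Data.Product using (Σ; ∃; _×_; _,_)
open import Data.Sum using (_⊎_)
open import Function.Bundles using (_⇔_)

State : Set → Set₁
State W = W → Set

_⊆ˢ_ : {W : Set} → State W → State W → Set
s ⊆ˢ t = ∀ w → s w → t w

record InqModel (P : Set) : Set₂ where
  field
    World   : Set
    Sig     : World → State World → Set
    Val     : P → World → Set
    Sig-nonempty : ∀ w → ∃ λ s → Sig w s
    Sig-closed   : ∀ w s t → Sig w s → t ⊆ˢ s → Sig w t

open InqModel public

-- A relation Z ⊆ (W × W') ∪ (℘(W) × ℘(W')), given by its world part
-- and its state part.
record MixedRel (W W' : Set) : Set₂ where
  constructor mixed
  field
    wRel : W → W' → Set
    sRel : State W → State W' → Set

open MixedRel public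

lift : {W W' : Set} → (W → W' → Set) → State W → State W' → Set
lift Y s s' = (∀ w → s w → ∃ λ w' → s' w' × Y w w')
            × (∀ w' → s' w' → ∃ λ w → s w × Y w w')

module _ {P : Set} (M M' : InqModel P) where

  private
    W  = World M
    W' = World M'

  record IsBisimulation (Z : MixedRel W W') : Set₁ where
    field
      nonempty : (∃ λ w → ∃ λ w' → wRel Z w w')
               ⊎ (∃ λ s → ∃ λ s' → sRel Z s s')
      atoms    : ∀ w w' → wRel Z w w' → ∀ p → Val M p w ⇔ Val M' p w'
      st-forth : ∀ s s' → sRel Z s s' → ∀ w → s w → ∃ λ w' → s' w' × wRel Z w w'
      st-back  : ∀ s s' → sRel Z s s' → ∀ w' → s' w' → ∃ λ w → s w × wRel Z w w'
      forth    : ∀ w w' → wRel Z w w' → ∀ s → Sig M w s →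
                 ∃ λ s' → Sig M' w' s' × sRel Z s s'
      back     : ∀ w w' → wRel Z w w' → ∀ s' → Sig M' w' s' →
                 ∃ λ s → Sig M w s × sRel Z s s'

  record IsWorldBisimulation (Y : W → W' → Set) : Set₁ where
    field
      nonempty : ∃ λ w → ∃ λ w' → Y w w'
      atoms    : ∀ w w' → Y w w' → ∀ p → Val M p w ⇔ Val M' p w'
      forth    : ∀ w w' → Y w w' → ∀ s → Sig M w s →
                 ∃ λ s' → Sig M' w' s' × lift Y s s'
      back     : ∀ w w' → Y w w' → ∀ s' → Sig M' w' s' →
                 ∃ λ s → Sig M w s × lift Y s s'

worldPart : {W W' : Set} → MixedRel W W' → W → W' → Set
worldPart Z = wRel Z

withLift : {W W' : Set} → (W → W' → Set) → MixedRel W W'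
withLift Y = mixed Y (lift Y)

{-# OPTIONS --safe #-}
module Submission where

open import Defs
open import Data.Product using (∃; _×_; _,_; proj₁; proj₂; map₂)
open import Data.Sum using (inj₁)

module _ {P : Set} {M M' : InqModel P} where

  sRel⊆lift-wRel : {Z : MixedRel (World M) (World M')} → IsBisimulation M M' Z →
                   ∀ {s s'} → sRel Z s s' → lift (wRel Z) s s'
  sRel⊆lift-wRel B {s} {s'} sZs' = st-forth s s' sZs' , st-back s s' sZs'
    where open IsBisimulation B

  -- Z may relate only the empty states, so non-emptiness of Z• is not automatic.
  worldPart-isWorldBisimulation : {Z : MixedRel (World M) (World M')} →
    IsBisimulation M M' Z → (∃ λ w → ∃ λ w' → wRel Z w w') →
    IsWorldBisimulation M M' (worldPart Z)
  worldPart-isWorldBisimulation B worldsRelated = record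
    { nonempty = worldsRelated
    ; atoms    = atoms
    ; forth    = λ w w' wZw' s s∈Σw → map₂ (map₂ (sRel⊆lift-wRel B)) (forth w w' wZw' s s∈Σw)
    ; back     = λ w w' wZw' s' s'∈Σw' → map₂ (map₂ (sRel⊆lift-wRel B)) (back w w' wZw' s' s'∈Σw')
    }
    where open IsBisimulation B

  withLift-isBisimulation : {Y : World M → World M' → Set} →
    IsWorldBisimulation M M' Y → IsBisimulation M M' (withLift Y)
  withLift-isBisimulation B = record
    { nonempty = inj₁ nonempty
    ; atoms    = atoms
    ; st-forth = λ _ _ → proj₁
    ; st-back  = λ _ _ → proj₂
    ; forth    = forth
    ; back     = back
    }
    where open IsWorldBisimulation B

proposition3p6 : {P : Set} (M M' : InqModel P) →
    ((Z : MixedRel (World M) (World M')) →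
       IsBisimulation M M' Z →
       (∃ λ w → ∃ λ w' → wRel Z w w') →
       IsWorldBisimulation M M' (worldPart Z))
    ×
    ((Y : World M → World M' → Set) →
       IsWorldBisimulation M M' Y →
       IsBisimulation M M' (withLift Y))
proposition3p6 M M' =
  (λ Z → worldPart-isWorldBisimulation) , (λ Y → withLift-isBisimulation)
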